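{- Let $k,r\in\mathbb N$, let $e_1,\dots,e_k$ be the standard basis of $\mathbb Z^k$, and $B=\{e_1,\dots,e_k\}$. For every $h\in\mathbb N_0$ there exists a set $Y_h\subseteq\mathbb Z^k$ with $|Y_h|\le\binom{(r+1)(k-1)}{k-1}$ such that $(rh)B\subseteq Y_h+hB$.
   Context: $\mathbb N=\{1,2,\dots\}$, $\mathbb N_0=\{0,1,2,\dots\}$. For subsets $X,Y$, $X+Y=\{x+y:x\in X,y\in Y\}$; for $h\in\mathbb N$, $hB$ is the $h$-fold sumset $B+\cdots+B$ and $0B=\{0\}$; thus $hB=\{x\in\mathbb Z_{\ge0}^k:x_1+\cdots+x_k=h\}$. -}

module Defs where

open import Data.Nat using (ℕ; zero; suc)
open import Data.Integer using (ℤ; +_)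
open import Data.Fin using (Fin)
import Data.Fin as Fin
open import Data.Vec using (Vec; tabulate; replicate; zipWith)
open import Data.Bool using (if_then_else_)
open import Relation.Nullary.Decidable using (⌊_⌋)
import Data.Integer as ℤ

ℤ^ : ℕ → Set
ℤ^ k = Vec ℤ k

_⊕_ : ∀ {k} → ℤ^ k → ℤ^ k → ℤ^ k
_⊕_ = zipWith ℤ._+_

𝟎 : ∀ {k} → ℤ^ k
𝟎 = replicate _ (+ 0)

e : ∀ {k} → Fin k → ℤ^ k
e i = tabulate (λ j → if ⌊ i Fin.≟ j ⌋ then + 1 else + 0)

data InB {k : ℕ} : ℤ^ k → Set where
  basis : (i : Fin k) → InB (e i)

data InSumset {k : ℕ} : ℕ → ℤ^ k → Set where
  zeroB : InSumset zero 𝟎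
  sucB  : ∀ {h x b} → InSumset h x → InB b → InSumset (suc h) (x ⊕ b)

{-# OPTIONS --safe #-}
module Submission where

-- Write x ∈ (rh)B as (a₀, a₁, …, aₘ) with m = k − 1 (the cases h = 0 and k = 1 are immediate).
-- Round each aᵢ down to the grid point sᵢ = ⌈wᵢh/m⌉, where wᵢ = ⌊maᵢ/h⌋: since
-- wᵢh/m ≤ aᵢ < (wᵢ + 1)h/m we get 0 ≤ aᵢ − sᵢ ≤ h/m, and Σ wᵢ ≤ m·Σ aᵢ/h ≤ mr.
-- Hence x = y + z with y = ((r − 1)h − Σ sᵢ, s₁, …, sₘ), which depends on w alone, and
-- z = (h − Σ (aᵢ − sᵢ), a₁ − s₁, …, aₘ − sₘ) ∈ hB. There are C(mr + m, m) vectors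
-- w ∈ ℕᵐ with Σ wᵢ ≤ mr (Pascal's rule on the first coordinate).

open import Defs
open import Data.Bool using (if_then_else_)
open import Data.Fin using (Fin)
import Data.Fin as Fin
open import Data.Integer using (ℤ)
import Data.Integer as ℤ
import Data.Integer.Properties as ℤ
open import Data.Integer.Solver using (module +-*-Solver)
open import Data.List using (List; [_]; length; _++_) renaming (map to mapᴸ)
open import Data.List.Membership.Propositional using (_∈_)
open import Data.List.Membership.Propositional.Properties
  using (∈-map⁺; ∈-++⁺ˡ; ∈-++⁺ʳ; ∈-length)
open import Data.List.Properties using (length-map; length-++)
open import Data.List.Relation.Unary.Any using (here)
open import Data.Nat using (ℕ; zero; suc; pred; _+_; _*_; _∸_; _≤_; _<_; z≤n; s≤s; NonZero)
open import Data.Nat.Combinatorics using (_C_; nCn≡1; nCk+nC[k+1]≡[n+1]C[k+1])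
open import Data.Nat.DivMod using (_/_; _%_; m≡m%n+[m/n]*n; m%n<n; m/n*n≤m; m<n*o⇒m/o<n)
open import Data.Nat.Properties
open import Algebra.Properties.CommutativeSemigroup +-commutativeSemigroup
  using (interchange; xy∙z≈zx∙y)
open import Data.Product using (Σ; _×_; _,_)
open import Data.Vec using (Vec; []; _∷_; map; zipWith; sum; replicate; tabulate)
open import Data.Vec.Properties
  using (map-replicate; map-const; tabulate-∘; tabulate-cong; zipWith-identityˡ; zipWith-identityʳ)
open import Function using (_∘_; const; id)
open import Relation.Binary.PropositionalEquality
  using (_≡_; refl; sym; trans; cong; cong₂; subst; module ≡-Reasoning)
open import Relation.Nullary.Decidable using (⌊⌋-map′)

toℤ^ : ∀ {k} → Vec ℕ k → ℤ^ k
toℤ^ = map (λ n → ℤ.+ n)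

infixl 6 _+ᵥ_

_+ᵥ_ : ∀ {k} → Vec ℕ k → Vec ℕ k → Vec ℕ k
_+ᵥ_ = zipWith _+_

toℤ^-+ᵥ : ∀ {k} (a b : Vec ℕ k) → toℤ^ (a +ᵥ b) ≡ toℤ^ a ⊕ toℤ^ b
toℤ^-+ᵥ []      []      = refl
toℤ^-+ᵥ (x ∷ a) (y ∷ b) = cong₂ _∷_ (ℤ.pos-+ x y) (toℤ^-+ᵥ a b)

sum-+ᵥ : ∀ {k} (a b : Vec ℕ k) → sum (a +ᵥ b) ≡ sum a + sum b
sum-+ᵥ []      []      = refl
sum-+ᵥ (x ∷ a) (y ∷ b) =
  trans (cong ((x + y) +_) (sum-+ᵥ a b)) (interchange x y (sum a) (sum b))

c*sum-map≤n*b : ∀ {A : Set} {n c b} {f : A → ℕ} →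
  (∀ x → c * f x ≤ b) → (v : Vec A n) → c * sum (map f v) ≤ n * b
c*sum-map≤n*b {c = c} _ [] = ≤-reflexive (*-zeroʳ c)
c*sum-map≤n*b {n = suc n} {c} {b} {f} bound (x ∷ v) = begin
  c * (f x + sum (map f v))     ≡⟨ *-distribˡ-+ c (f x) _ ⟩
  c * f x + c * sum (map f v)   ≤⟨ +-mono-≤ (bound x) (c*sum-map≤n*b {c = c} bound v) ⟩
  b + n * b                     ∎
  where open ≤-Reasoning

sum-map*b≤c*sum : ∀ {n c b} {f : ℕ → ℕ} →
  (∀ t → f t * b ≤ c * t) → (v : Vec ℕ n) → sum (map f v) * b ≤ c * sum v
sum-map*b≤c*sum _ [] = z≤n
sum-map*b≤c*sum {c = c} {b} {f} bound (t ∷ v) = begin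
  (f t + sum (map f v)) * b     ≡⟨ *-distribʳ-+ b (f t) _ ⟩
  f t * b + sum (map f v) * b   ≤⟨ +-mono-≤ (bound t) (sum-map*b≤c*sum {c = c} bound v) ⟩
  c * t + c * sum v             ≡⟨ *-distribˡ-+ c t (sum v) ⟨
  c * (t + sum v)               ∎
  where open ≤-Reasoning

𝟎≡toℤ^-replicate : ∀ k → 𝟎 ≡ toℤ^ (replicate k 0)
𝟎≡toℤ^-replicate k = sym (map-replicate (λ n → ℤ.+ n) 0 k)

sum-replicate-zero : ∀ k → sum (replicate k 0) ≡ 0
sum-replicate-zero zero    = refl
sum-replicate-zero (suc k) = sum-replicate-zero k

sum≡0⇒≡replicate : ∀ {k} (a : Vec ℕ k) → sum a ≡ 0 → a ≡ replicate k 0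
sum≡0⇒≡replicate []         _    = refl
sum≡0⇒≡replicate (zero ∷ a) Σa≡0 = cong (0 ∷_) (sum≡0⇒≡replicate a Σa≡0)

unit : ∀ {k} → Fin k → Vec ℕ k
unit {suc k} Fin.zero = 1 ∷ replicate k 0
unit (Fin.suc i)      = 0 ∷ unit i

sum-unit : ∀ {k} (i : Fin k) → sum (unit i) ≡ 1
sum-unit {suc k} Fin.zero = cong suc (sum-replicate-zero k)
sum-unit (Fin.suc i)      = sum-unit i

e-suc : ∀ {k} (i : Fin k) → e (Fin.suc i) ≡ ℤ.+ 0 ∷ e i
e-suc i = cong (ℤ.+ 0 ∷_) (tabulate-cong λ j →
  cong (λ b → if b then ℤ.+ 1 else ℤ.+ 0) (⌊⌋-map′ _ _ (i Fin.≟ j)))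

e≡toℤ^-unit : ∀ {k} (i : Fin k) → e i ≡ toℤ^ (unit i)
e≡toℤ^-unit {suc k} Fin.zero = cong (ℤ.+ 1 ∷_) (begin
  tabulate (λ _ → ℤ.+ 0)             ≡⟨ tabulate-∘ (const (ℤ.+ 0)) id ⟩
  map (const (ℤ.+ 0)) (tabulate id)  ≡⟨ map-const (tabulate id) (ℤ.+ 0) ⟩
  𝟎                                  ≡⟨ 𝟎≡toℤ^-replicate k ⟩
  toℤ^ (replicate k 0)               ∎)
  where open ≡-Reasoning
e≡toℤ^-unit (Fin.suc i) = trans (e-suc i) (cong (ℤ.+ 0 ∷_) (e≡toℤ^-unit i))

toℤ^-+ᵥ-unit : ∀ {k} (a : Vec ℕ k) (i : Fin k) → toℤ^ (a +ᵥ unit i) ≡ toℤ^ a ⊕ e i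
toℤ^-+ᵥ-unit a i = trans (toℤ^-+ᵥ a (unit i)) (cong (toℤ^ a ⊕_) (sym (e≡toℤ^-unit i)))

split-unit : ∀ {k n} (a : Vec ℕ k) → sum a ≡ suc n →
  Σ (Vec ℕ k) λ a′ → Σ (Fin k) λ i → sum a′ ≡ n × a ≡ a′ +ᵥ unit i
split-unit (suc x ∷ a) refl =
  x ∷ a , Fin.zero , refl , cong₂ _∷_ (+-comm 1 x) (sym (zipWith-identityʳ +-identityʳ a))
split-unit (zero ∷ a) Σa≡ with split-unit a Σa≡
... | a′ , i , Σa′≡ , a≡ = 0 ∷ a′ , Fin.suc i , Σa′≡ , cong (0 ∷_) a≡

InSumset⇒sum≡ : ∀ {k n} {x : ℤ^ k} → InSumset n x →
  Σ (Vec ℕ k) λ a → x ≡ toℤ^ a × sum a ≡ n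
InSumset⇒sum≡ {k} zeroB = replicate k 0 , 𝟎≡toℤ^-replicate k , sum-replicate-zero k
InSumset⇒sum≡ (sucB x∈ (basis i)) with InSumset⇒sum≡ x∈
... | a , refl , refl = a +ᵥ unit i , sym (toℤ^-+ᵥ-unit a i) ,
  trans (sum-+ᵥ a (unit i)) (trans (cong (sum a +_) (sum-unit i)) (+-comm (sum a) 1))

sum≡⇒InSumset : ∀ {k} n (a : Vec ℕ k) → sum a ≡ n → InSumset n (toℤ^ a)
sum≡⇒InSumset zero a Σa≡0 with sum≡0⇒≡replicate a Σa≡0
... | refl = subst (InSumset 0) (𝟎≡toℤ^-replicate _) zeroB
sum≡⇒InSumset (suc n) a Σa≡ with split-unit a Σa≡
... | a′ , i , Σa′≡ , refl =
  subst (InSumset (suc n)) (sym (toℤ^-+ᵥ-unit a′ i)) (sucB (sum≡⇒InSumset n a′ Σa′≡) (basis i))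

incrementHead : ∀ {n} → Vec ℕ (suc n) → Vec ℕ (suc n)
incrementHead (x ∷ v) = suc x ∷ v

sumAtMost : (n N : ℕ) → List (Vec ℕ n)
sumAtMost zero    N       = [ [] ]
sumAtMost (suc n) zero    = mapᴸ (0 ∷_) (sumAtMost n zero)
sumAtMost (suc n) (suc N) =
  mapᴸ incrementHead (sumAtMost (suc n) N) ++ mapᴸ (0 ∷_) (sumAtMost n (suc N))

∈-sumAtMost : ∀ {n N} (w : Vec ℕ n) → sum w ≤ N → w ∈ sumAtMost n N
∈-sumAtMost []                            _         = here refl
∈-sumAtMost {N = zero}      (zero ∷ w)    Σw≤       = ∈-map⁺ (0 ∷_) (∈-sumAtMost w Σw≤)
∈-sumAtMost {suc n} {suc N} (zero ∷ w)    Σw≤       =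
  ∈-++⁺ʳ (mapᴸ incrementHead (sumAtMost (suc n) N)) (∈-map⁺ (0 ∷_) (∈-sumAtMost w Σw≤))
∈-sumAtMost {N = suc N}     (suc x ∷ w)   (s≤s Σw≤) =
  ∈-++⁺ˡ (∈-map⁺ incrementHead (∈-sumAtMost (x ∷ w) Σw≤))

length-sumAtMost : ∀ n N → length (sumAtMost n N) ≡ (N + n) C n
length-sumAtMost zero    N    = refl
length-sumAtMost (suc n) zero = begin
  length (mapᴸ (0 ∷_) (sumAtMost n zero))  ≡⟨ length-map (0 ∷_) (sumAtMost n zero) ⟩
  length (sumAtMost n zero)                 ≡⟨ length-sumAtMost n zero ⟩
  n C n                                     ≡⟨ trans (nCn≡1 n) (sym (nCn≡1 (suc n))) ⟩
  suc n C suc n                             ∎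
  where open ≡-Reasoning
length-sumAtMost (suc n) (suc N) = begin
  length (mapᴸ incrementHead (sumAtMost (suc n) N) ++ mapᴸ (0 ∷_) (sumAtMost n (suc N)))
    ≡⟨ length-++ (mapᴸ incrementHead (sumAtMost (suc n) N)) ⟩
  length (mapᴸ incrementHead (sumAtMost (suc n) N)) + length (mapᴸ (0 ∷_) (sumAtMost n (suc N)))
    ≡⟨ cong₂ _+_ (length-map incrementHead (sumAtMost (suc n) N)) (length-map (0 ∷_) (sumAtMost n (suc N))) ⟩
  length (sumAtMost (suc n) N) + length (sumAtMost n (suc N))
    ≡⟨ cong₂ _+_ (length-sumAtMost (suc n) N) (length-sumAtMost n (suc N)) ⟩
  (N + suc n) C suc n + (suc N + n) C n
    ≡⟨ cong (λ M → (N + suc n) C suc n + M C n) (sym (+-suc N n)) ⟩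
  (N + suc n) C suc n + (N + suc n) C n
    ≡⟨ +-comm ((N + suc n) C suc n) _ ⟩
  (N + suc n) C n + (N + suc n) C suc n
    ≡⟨ nCk+nC[k+1]≡[n+1]C[k+1] (N + suc n) n ⟩
  suc (N + suc n) C suc n
    ∎
  where open ≡-Reasoning

length-sumAtMost-* : ∀ r n → length (sumAtMost n (n * r)) ≡ ((r + 1) * n) C n
length-sumAtMost-* r n = trans (length-sumAtMost n (n * r)) (cong (_C n) (begin
  n * r + n      ≡⟨ cong₂ _+_ (*-comm n r) (sym (*-identityˡ n)) ⟩
  r * n + 1 * n  ≡⟨ *-distribʳ-+ n r 1 ⟨
  (r + 1) * n    ∎))
  where open ≡-Reasoning

0<[[r+1]*n]Cn : ∀ r n → 0 < ((r + 1) * n) C n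
0<[[r+1]*n]Cn r n = subst (0 <_) (length-sumAtMost-* r n)
  (∈-length (∈-sumAtMost (replicate n 0) (≤-trans (≤-reflexive (sum-replicate-zero n)) z≤n)))

⌈_/_⌉ : (m n : ℕ) .{{_ : NonZero n}} → ℕ
⌈ m / n ⌉ = (m + pred n) / n

m≤⌈m/n⌉*n : ∀ m n .{{_ : NonZero n}} → m ≤ ⌈ m / n ⌉ * n
m≤⌈m/n⌉*n m n = +-cancelʳ-≤ (pred n) m (⌈ m / n ⌉ * n) (begin
  m + pred n                        ≡⟨ m≡m%n+[m/n]*n (m + pred n) n ⟩
  (m + pred n) % n + ⌈ m / n ⌉ * n  ≤⟨ +-monoˡ-≤ (⌈ m / n ⌉ * n) (<⇒≤pred (m%n<n (m + pred n) n)) ⟩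
  pred n + ⌈ m / n ⌉ * n            ≡⟨ +-comm (pred n) _ ⟩
  ⌈ m / n ⌉ * n + pred n            ∎)
  where open ≤-Reasoning

m≤o*n⇒⌈m/n⌉≤o : ∀ {m n o} .{{_ : NonZero n}} → m ≤ o * n → ⌈ m / n ⌉ ≤ o
m≤o*n⇒⌈m/n⌉≤o {m} {n} {o} m≤o*n = ≤-pred (m<n*o⇒m/o<n (begin-strict
  m + pred n      ≤⟨ +-monoˡ-≤ (pred n) m≤o*n ⟩
  o * n + pred n  <⟨ +-monoʳ-< (o * n) (m≤pred[n]⇒suc[m]≤n ≤-refl) ⟩
  o * n + n       ≡⟨ +-comm (o * n) n ⟩
  suc o * n       ∎))
  where open ≤-Reasoning

m<[m/n]*n+n : ∀ m n .{{_ : NonZero n}} → m < m / n * n + n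
m<[m/n]*n+n m n = begin-strict
  m                  ≡⟨ m≡m%n+[m/n]*n m n ⟩
  m % n + m / n * n  <⟨ +-monoˡ-< (m / n * n) (m%n<n m n) ⟩
  n + m / n * n      ≡⟨ +-comm n _ ⟩
  m / n * n + n      ∎
  where open ≤-Reasoning

In⊕Sumset : ∀ {k} → List (ℤ^ k) → ℕ → ℤ^ k → Set
In⊕Sumset {k} Y h x = Σ (ℤ^ k) λ y → Σ (ℤ^ k) λ z → (y ∈ Y) × InSumset h z × (x ≡ y ⊕ z)

corner : ∀ {n} → ℕ → Vec ℕ n → ℤ^ (suc n)
corner p s = (ℤ.+ p ℤ.- ℤ.+ sum s) ∷ toℤ^ s

a+s≡p+d⇒a≡p-s+d : ∀ {a s p d : ℤ} → a ℤ.+ s ≡ p ℤ.+ d → a ≡ (p ℤ.- s) ℤ.+ d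
a+s≡p+d⇒a≡p-s+d {a} {s} {p} {d} eq = begin
  a                  ≡⟨ solve 2 (λ a s → a := (a :+ s) :- s) refl a s ⟩
  (a ℤ.+ s) ℤ.- s    ≡⟨ cong (ℤ._- s) eq ⟩
  (p ℤ.+ d) ℤ.- s    ≡⟨ solve 3 (λ p d s → (p :+ d) :- s := (p :- s) :+ d) refl p d s ⟩
  (p ℤ.- s) ℤ.+ d    ∎
  where open ≡-Reasoning; open +-*-Solver

corner⊕Sumset : ∀ {n} h p a₀ {a s c : Vec ℕ n} →
  s +ᵥ c ≡ a → sum c ≤ h → a₀ + sum a ≡ h + p →
  Σ (ℤ^ (suc n)) λ z → InSumset h z × toℤ^ (a₀ ∷ a) ≡ corner p s ⊕ z
corner⊕Sumset h p a₀ {s = s} {c} refl Σc≤h Σ≡ =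
  toℤ^ (h ∸ sum c ∷ c) , sum≡⇒InSumset h _ (m∸n+n≡m Σc≤h) , cong₂ _∷_ head (toℤ^-+ᵥ s c)
  where
  balance : a₀ + sum s ≡ p + (h ∸ sum c)
  balance = +-cancelʳ-≡ (sum c) _ _ (begin
    a₀ + sum s + sum c      ≡⟨ +-assoc a₀ (sum s) (sum c) ⟩
    a₀ + (sum s + sum c)    ≡⟨ cong (a₀ +_) (sum-+ᵥ s c) ⟨
    a₀ + sum (s +ᵥ c)       ≡⟨ Σ≡ ⟩
    h + p                   ≡⟨ cong (_+ p) (m∸n+n≡m Σc≤h) ⟨
    h ∸ sum c + sum c + p   ≡⟨ xy∙z≈zx∙y (h ∸ sum c) (sum c) p ⟩
    p + (h ∸ sum c) + sum c ∎)
    where open ≡-Reasoning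
  head : ℤ.+ a₀ ≡ (ℤ.+ p ℤ.- ℤ.+ sum s) ℤ.+ ℤ.+ (h ∸ sum c)
  head = a+s≡p+d⇒a≡p-s+d {s = ℤ.+ sum s} {p = ℤ.+ p}
    (trans (sym (ℤ.pos-+ a₀ (sum s))) (trans (cong ℤ.+_ balance) (ℤ.pos-+ p _)))

covers₁ : ∀ h p (x : ℤ^ 1) → InSumset (h + p) x → In⊕Sumset [ corner p [] ] h x
covers₁ h p x x∈ with InSumset⇒sum≡ x∈
... | a₀ ∷ [] , refl , Σ≡ with corner⊕Sumset h p a₀ {s = []} {c = []} refl z≤n Σ≡
...   | z , z∈hB , x≡ = corner p [] , z , here refl , z∈hB , x≡

module Rounding (m h : ℕ) .{{_ : NonZero m}} .{{_ : NonZero h}} where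

  index : ℕ → ℕ
  index t = m * t / h

  gridPoint : ℕ → ℕ
  gridPoint j = ⌈ j * h / m ⌉

  snap : ℕ → ℕ
  snap t = gridPoint (index t)

  residue : ℕ → ℕ
  residue t = t ∸ snap t

  index*h≤m*t : ∀ t → index t * h ≤ m * t
  index*h≤m*t t = m/n*n≤m (m * t) h

  snap≤ : ∀ t → snap t ≤ t
  snap≤ t = m≤o*n⇒⌈m/n⌉≤o (≤-trans (index*h≤m*t t) (≤-reflexive (*-comm m t)))

  m*residue≤h : ∀ t → m * residue t ≤ h
  m*residue≤h t = begin
    m * (t ∸ snap t)    ≡⟨ *-distribˡ-∸ m t (snap t) ⟩
    m * t ∸ m * snap t  ≤⟨ m≤n+o⇒m∸n≤o (m * t) (m * snap t) (<⇒≤ m*t<m*snap+h) ⟩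
    h                   ∎
    where
    open ≤-Reasoning
    m*t<m*snap+h : m * t < m * snap t + h
    m*t<m*snap+h = begin-strict
      m * t            <⟨ m<[m/n]*n+n (m * t) h ⟩
      index t * h + h  ≤⟨ +-monoˡ-≤ h (m≤⌈m/n⌉*n (index t * h) m) ⟩
      snap t * m + h   ≡⟨ cong (_+ h) (*-comm (snap t) m) ⟩
      m * snap t + h   ∎

  snaps : ∀ {n} → Vec ℕ n → Vec ℕ n
  snaps a = map gridPoint (map index a)

  snaps+residues : ∀ {n} (a : Vec ℕ n) → snaps a +ᵥ map residue a ≡ a
  snaps+residues []      = refl
  snaps+residues (t ∷ a) = cong₂ _∷_ (m+[n∸m]≡n (snap≤ t)) (snaps+residues a)

  sum-residues≤ : (a : Vec ℕ m) → sum (map residue a) ≤ h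
  sum-residues≤ a = *-cancelˡ-≤ m (c*sum-map≤n*b {c = m} m*residue≤h a)

  sum-indices≤ : ∀ r (a : Vec ℕ m) → sum a ≤ r * h → sum (map index a) ≤ m * r
  sum-indices≤ r a Σa≤ = *-cancelʳ-≤ _ _ h (begin
    sum (map index a) * h  ≤⟨ sum-map*b≤c*sum {c = m} index*h≤m*t a ⟩
    m * sum a              ≤⟨ *-monoʳ-≤ m Σa≤ ⟩
    m * (r * h)            ≡⟨ *-assoc m r h ⟨
    m * r * h              ∎)
    where open ≤-Reasoning

  corners : ℕ → List (ℤ^ (suc m))
  corners r′ = mapᴸ (corner (r′ * h) ∘ map gridPoint) (sumAtMost m (m * suc r′))

  length-corners : ∀ r′ → length (corners r′) ≡ ((suc r′ + 1) * m) C m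
  length-corners r′ =
    trans (length-map _ (sumAtMost m (m * suc r′))) (length-sumAtMost-* (suc r′) m)

  covers : ∀ r′ (x : ℤ^ (suc m)) → InSumset (suc r′ * h) x → In⊕Sumset (corners r′) h x
  covers r′ x x∈ with InSumset⇒sum≡ x∈
  ... | a₀ ∷ a , refl , Σ≡
    with corner⊕Sumset h (r′ * h) a₀ (snaps+residues a) (sum-residues≤ a) Σ≡
  ... | z , z∈hB , x≡ = corner (r′ * h) (snaps a) , z , corner∈corners , z∈hB , x≡
    where
    corner∈corners : corner (r′ * h) (snaps a) ∈ corners r′
    corner∈corners = ∈-map⁺ _ (∈-sumAtMost (map index a)
      (sum-indices≤ (suc r′) a (subst (sum a ≤_) Σ≡ (m≤n+m (sum a) a₀))))

proposition2p6 : (k r : ℕ) → 1 ≤ k → 1 ≤ r → (h : ℕ) →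
    Σ (List (ℤ^ k)) (λ Y →
      (length Y ≤ ((r + 1) * (k ∸ 1)) C (k ∸ 1)) ×
      ((x : ℤ^ k) → InSumset (r * h) x →
        Σ (ℤ^ k) (λ y → Σ (ℤ^ k) (λ z →
          (y ∈ Y) × InSumset h z × (x ≡ y ⊕ z)))))
proposition2p6 zero _ () _ _
proposition2p6 _ zero _ () _
proposition2p6 k r _ _ zero = [ 𝟎 ] , 0<[[r+1]*n]Cn r (k ∸ 1) , λ x x∈ →
  𝟎 , x , here refl , subst (λ n → InSumset n x) (*-zeroʳ r) x∈ ,
  sym (zipWith-identityˡ ℤ.+-identityˡ x)
proposition2p6 (suc zero) (suc r′) _ _ h =
  [ corner (r′ * h) [] ] , 0<[[r+1]*n]Cn (suc r′) 0 , covers₁ h (r′ * h)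
proposition2p6 (suc (suc m′)) (suc r′) _ _ h@(suc _) =
  corners r′ , ≤-reflexive (length-corners r′) , covers r′
  where open Rounding (suc m′) h
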